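{- Let $q$ be a prime power, $\alpha$ a primitive element of $\mathbf{F}_q$, $k$ an integer with $1\le k\le q-2$, and $d=q-k$. Let $g(x)=(x-\alpha)(x-\alpha^2)\cdots(x-\alpha^{d-1})$ and let $\mathcal{C}=\{g(x)m(x): m\in\mathbf{F}_q[x],\ \deg m\le k-1\}$. Let $g_2(x)=g(x)/(x-\alpha^{d-1})$. Then for every $a\in\mathbf{F}_q^*$ and every $l\in\mathbf{F}_q[x]$ with $\deg l\le k-1$, the polynomial $a g_2(x)+l(x)g(x)$ is a deep hole of $\mathcal{C}$, i.e. $d(ag_2+lg,\mathcal{C})=q-1-k$.
   Context: Polynomials of degree at most $q-2$ are identified with their coefficient vectors in $\mathbf{F}_q^{q-1}$. The distance $d(s,t)$ between two such polynomials is the number of indices $i\in\{0,\dots,q-2\}$ at which the coefficients of $x^i$ in $s$ and $t$ differ, and $d(u,\mathcal{C})=\min\{d(u,c):c\in\mathcal{C}\}$. A polynomial $u$ of degree at most $q-2$ is a deep hole of $\mathcal{C}$ if $d(u,\mathcal{C})=q-1-k$. -}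

module Defs where

open import Level using (0ℓ)
open import Data.Nat as ℕ using (ℕ; zero; suc; _∸_; _≤_)
open import Data.Nat.Primality using (Prime)
open import Data.Fin using (Fin)
open import Data.Fin.Properties using () renaming (_≟_ to _≟Fin_)
open import Data.List using (List; []; _∷_)
open import Data.Vec using (Vec; toList)
open import Data.Product using (Σ; ∃; _×_; _,_)
open import Function.Bundles using (_↔_; Inverse)
open import Relation.Binary.PropositionalEquality using (_≡_; cong; sym; trans)
open import Relation.Nullary using (¬_; Dec; yes; no)
open import Relation.Nullary.Decidable using (map′)
open import Algebra.Core using (Op₁; Op₂)
open import Algebra.Structures using (IsCommutativeRing)

IsPrimePower : ℕ → Set
IsPrimePower q = Σ ℕ λ p → Σ ℕ λ r → Prime p × 1 ≤ r × q ≡ p ℕ.^ r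

record FiniteField (q : ℕ) : Set₁ where
  field
    Carrier : Set
    _+_ _*_ : Op₂ Carrier
    -_      : Op₁ Carrier
    0# 1#   : Carrier
    isCommutativeRing : IsCommutativeRing _≡_ _+_ _*_ -_ 0# 1#
    0≢1     : ¬ (0# ≡ 1#)
    inverse : ∀ x → ¬ (x ≡ 0#) → Σ Carrier λ y → x * y ≡ 1#
    enum    : Carrier ↔ Fin q

  _≟_ : (x y : Carrier) → Dec (x ≡ y)
  x ≟ y = map′ inj (cong (Inverse.to enum)) (Inverse.to enum x ≟Fin Inverse.to enum y)
    where
    inj : Inverse.to enum x ≡ Inverse.to enum y → x ≡ y
    inj e = trans (sym (Inverse.strictlyInverseʳ enum x))
                  (trans (cong (Inverse.from enum) e) (Inverse.strictlyInverseʳ enum y))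

module _ {q : ℕ} (F : FiniteField q) where
  open FiniteField F

  pow : Carrier → ℕ → Carrier
  pow x zero    = 1#
  pow x (suc n) = x * pow x n

  IsPrimitive : Carrier → Set
  IsPrimitive α = ∀ x → ¬ (x ≡ 0#) → Σ ℕ λ i → x ≡ pow α i

  -- Polynomials over F as coefficient lists (head = coefficient of x^0).
  Poly : Set
  Poly = List Carrier

  coeff : Poly → ℕ → Carrier
  coeff []       _       = 0#
  coeff (c ∷ p)  zero    = c
  coeff (c ∷ p)  (suc i) = coeff p i

  addP : Poly → Poly → Poly
  addP []       t        = t
  addP (c ∷ s)  []       = c ∷ s
  addP (c ∷ s)  (e ∷ t)  = (c + e) ∷ addP s t

  scaleP : Carrier → Poly → Poly
  scaleP a []      = []
  scaleP a (c ∷ s) = (a * c) ∷ scaleP a s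

  mulP : Poly → Poly → Poly
  mulP []      t = []
  mulP (c ∷ s) t = addP (scaleP c t) (0# ∷ mulP s t)

  rootProd : Carrier → ℕ → Poly
  rootProd α zero    = 1# ∷ []
  rootProd α (suc n) = mulP (rootProd α n) ((- pow α (suc n)) ∷ 1# ∷ [])

  dist : ℕ → Poly → Poly → ℕ
  dist zero    s t = 0
  dist (suc n) s t with coeff s n ≟ coeff t n
  ... | yes _ = dist n s t
  ... | no  _ = suc (dist n s t)

  -- The code C = { g m : deg m ≤ k - 1 }, with d = q - k, g = (x-α)...(x-α^(d-1)).
  -- A polynomial m with deg m ≤ k-1 is given by its k coefficients.
  gen : ℕ → Carrier → Poly
  gen k α = rootProd α (q ∸ k ∸ 1)

  codeword : (k : ℕ) → Carrier → Vec Carrier k → Poly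
  codeword k α m = mulP (gen k α) (toList m)

  -- d(u, C) = min over codewords c of d(u, c), distances measured on
  -- coefficients of x^0 .. x^(q-2).
  DistToCode≡ : (k : ℕ) → Carrier → Poly → ℕ → Set
  DistToCode≡ k α u r =
    (∀ (m : Vec Carrier k) → r ≤ dist (q ∸ 1) u (codeword k α m))
    × (Σ (Vec Carrier k) λ m → dist (q ∸ 1) u (codeword k α m) ≡ r)

  IsDeepHole : (k : ℕ) → Carrier → Poly → Set
  IsDeepHole k α u = DistToCode≡ k α u (q ∸ 1 ∸ k)

{-# OPTIONS --safe #-}

-- Let w = d - 2, so that g = g₂ (x - β) with β = α^(w+1). For every codeword g m the
-- difference u - g m = a g₂ + (l - m) g vanishes at α, …, α^w but not at β, where it equals
-- a g₂(β) ≠ 0. By the BCH bound (a polynomial of degree < q - 1 with at most w nonzero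
-- coefficients that vanishes at α, …, α^w is zero) u - g m has at least w + 1 = q - 1 - k
-- nonzero coefficients. The bound is attained at m = l - a/β, where u - g m = (a/β) x g₂.

module Submission where

open import Defs
open import Level using (0ℓ)
open import Data.Nat as ℕ using (ℕ; zero; suc; _<_; _≤_; _∸_; z≤n; s≤s)
import Data.Nat.Properties as ℕₚ
open import Data.Nat.DivMod using (_%_; _/_; m%n<n; m≡m%n+[m/n]*n)
open import Data.Integer as ℤ using (ℤ; +_; -[1+_]; _⊖_; _◃_; sign; ∣_∣)
import Data.Integer.Properties as ℤₚ
open import Data.Sign as Sign using (Sign)
open import Data.Fin as Fin using (Fin; fromℕ; fromℕ<; inject₁)
import Data.Fin.Properties as Finₚ
open import Data.List using ([]; _∷_; length)
open import Data.Vec using (Vec; _∷_; toList)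
open import Data.Vec.Properties using (length-toList)
open import Data.Maybe using (map)
open import Data.Product using (Σ; _×_; _,_; proj₁)
open import Data.Sum using (inj₁; inj₂)
open import Data.Empty using (⊥-elim)
open import Function using (_∘_)
open import Function.Bundles using (Injection; Inverse)
open import Function.Construct.Symmetry using (↔-sym)
open import Function.Properties.Inverse using (↔⇒↣)
open import Algebra.Bundles using (CommutativeRing)
open import Algebra.Solver.Ring.AlmostCommutativeRing
  using (fromCommutativeRing; _-Raw-AlmostCommutative⟶_)
open import Relation.Binary.Consequences using (dec⇒weaklyDec)
open import Relation.Binary.Definitions using (tri<; tri≈; tri>)
import Relation.Binary.PropositionalEquality as ≡
open ≡ using (_≡_; _≢_; refl; sym; trans; cong; cong₂; subst)
open import Relation.Nullary using (¬_; yes; no)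

-- The ring solver decides equality of coefficients by computation, which the field's own
-- decidable equality cannot do on open terms; so the integers, mapped into R by fromℤ, are used.
module IntegerCoefficientSolver {c ℓ} (R : CommutativeRing c ℓ) where
  open CommutativeRing R renaming (refl to ≈-refl; sym to ≈-sym; trans to ≈-trans)
  open import Algebra.Properties.Ring ring using (-1*x≈-x)
  open import Algebra.Properties.Group +-group using (ε⁻¹≈ε; ⁻¹-involutive)
  open import Algebra.Properties.AbelianGroup +-abelianGroup using (⁻¹-∙-comm)
  open import Algebra.Properties.CommutativeSemigroup +-commutativeSemigroup
    using () renaming (interchange to +-interchange)
  open import Algebra.Properties.CommutativeSemigroup *-commutativeSemigroup
    using () renaming (interchange to *-interchange)
  open import Algebra.Properties.Semiring.Mult semiring using (×-homo-+; ×1-homo-*)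
    renaming (_×_ to infixr 8 _·_)
  open import Relation.Binary.Reasoning.Setoid setoid

  fromℤ : ℤ → Carrier
  fromℤ (+ n     ) = n · 1#
  fromℤ (-[1+ n ]) = - (suc n · 1#)

  sgn : Sign → Carrier
  sgn Sign.+ = 1#
  sgn Sign.- = - 1#

  fromℤ-homo-neg : ∀ i → fromℤ (ℤ.- i) ≈ - fromℤ i
  fromℤ-homo-neg (+ zero)  = ≈-sym ε⁻¹≈ε
  fromℤ-homo-neg (+ suc n) = ≈-refl
  fromℤ-homo-neg -[1+ n ]  = ≈-sym (⁻¹-involutive _)

  [1+x]-[1+y]≈x-y : ∀ x y → (1# + x) + - (1# + y) ≈ x + - y
  [1+x]-[1+y]≈x-y x y = begin
    (1# + x) + - (1# + y)    ≈⟨ +-congˡ (⁻¹-∙-comm 1# y) ⟨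
    (1# + x) + (- 1# + - y)  ≈⟨ +-interchange 1# x (- 1#) (- y) ⟩
    (1# + - 1#) + (x + - y)  ≈⟨ +-congʳ (-‿inverseʳ 1#) ⟩
    0# + (x + - y)           ≈⟨ +-identityˡ (x + - y) ⟩
    x + - y                  ∎

  fromℤ-homo-⊖ : ∀ m n → fromℤ (m ⊖ n) ≈ m · 1# + - (n · 1#)
  fromℤ-homo-⊖ zero    zero    = ≈-sym (-‿inverseʳ 0#)
  fromℤ-homo-⊖ zero    (suc n) = ≈-sym (+-identityˡ _)
  fromℤ-homo-⊖ (suc m) zero    = ≈-sym (≈-trans (+-congˡ ε⁻¹≈ε) (+-identityʳ _))
  fromℤ-homo-⊖ (suc m) (suc n) = begin
    fromℤ (suc m ⊖ suc n)        ≡⟨ ≡.cong fromℤ (ℤₚ.[1+m]⊖[1+n]≡m⊖n m n) ⟩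
    fromℤ (m ⊖ n)                ≈⟨ fromℤ-homo-⊖ m n ⟩
    m · 1# + - (n · 1#)          ≈⟨ [1+x]-[1+y]≈x-y (m · 1#) (n · 1#) ⟨
    suc m · 1# + - (suc n · 1#)  ∎

  fromℤ-homo-+ : ∀ i j → fromℤ (i ℤ.+ j) ≈ fromℤ i + fromℤ j
  fromℤ-homo-+ (+ m)     (+ n)     = ×-homo-+ 1# m n
  fromℤ-homo-+ (+ m)     -[1+ n ]  = fromℤ-homo-⊖ m (suc n)
  fromℤ-homo-+ -[1+ m ]  (+ n)     = ≈-trans (fromℤ-homo-⊖ n (suc m)) (+-comm _ _)
  fromℤ-homo-+ -[1+ m ]  -[1+ n ]  = begin
    - (suc (suc (m ℕ.+ n)) · 1#)      ≡⟨ ≡.cong (λ k → - (k · 1#)) (≡.sym (ℕₚ.+-suc (suc m) n)) ⟩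
    - ((suc m ℕ.+ suc n) · 1#)        ≈⟨ -‿cong (×-homo-+ 1# (suc m) (suc n)) ⟩
    - (suc m · 1# + suc n · 1#)       ≈⟨ ⁻¹-∙-comm _ _ ⟨
    - (suc m · 1#) + - (suc n · 1#)   ∎

  fromℤ-◃ : ∀ s n → fromℤ (s ◃ n) ≈ sgn s * (n · 1#)
  fromℤ-◃ s        zero    = ≈-sym (zeroʳ (sgn s))
  fromℤ-◃ Sign.+   (suc n) = ≈-sym (*-identityˡ _)
  fromℤ-◃ Sign.-   (suc n) = ≈-sym (-1*x≈-x _)

  sgn-homo : ∀ s t → sgn (s Sign.* t) ≈ sgn s * sgn t
  sgn-homo Sign.+ t      = ≈-sym (*-identityˡ (sgn t))
  sgn-homo Sign.- Sign.+ = ≈-sym (*-identityʳ (- 1#))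
  sgn-homo Sign.- Sign.- = ≈-sym (≈-trans (-1*x≈-x (- 1#)) (⁻¹-involutive 1#))

  fromℤ-homo-* : ∀ i j → fromℤ (i ℤ.* j) ≈ fromℤ i * fromℤ j
  fromℤ-homo-* i j = begin
    fromℤ ((sign i Sign.* sign j) ◃ (∣ i ∣ ℕ.* ∣ j ∣))
      ≈⟨ fromℤ-◃ (sign i Sign.* sign j) (∣ i ∣ ℕ.* ∣ j ∣) ⟩
    sgn (sign i Sign.* sign j) * ((∣ i ∣ ℕ.* ∣ j ∣) · 1#)
      ≈⟨ *-cong (sgn-homo (sign i) (sign j)) (×1-homo-* ∣ i ∣ ∣ j ∣) ⟩
    (sgn (sign i) * sgn (sign j)) * ((∣ i ∣ · 1#) * (∣ j ∣ · 1#))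
      ≈⟨ *-interchange _ _ _ _ ⟩
    (sgn (sign i) * (∣ i ∣ · 1#)) * (sgn (sign j) * (∣ j ∣ · 1#))
      ≈⟨ *-cong (fromℤ≈sgn*∣∣ i) (fromℤ≈sgn*∣∣ j) ⟨
    fromℤ i * fromℤ j
      ∎
    where
    fromℤ≈sgn*∣∣ : ∀ i → fromℤ i ≈ sgn (sign i) * (∣ i ∣ · 1#)
    fromℤ≈sgn*∣∣ i =
      ≈-trans (reflexive (≡.cong fromℤ (≡.sym (ℤₚ.◃-inverse i)))) (fromℤ-◃ (sign i) ∣ i ∣)

  homomorphism : ℤ.+-*-rawRing -Raw-AlmostCommutative⟶ fromCommutativeRing R
  homomorphism = record
    { ⟦_⟧    = fromℤ
    ; +-homo = fromℤ-homo-+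
    ; *-homo = fromℤ-homo-*
    ; -‿homo = fromℤ-homo-neg
    ; 0-homo = ≈-refl
    ; 1-homo = +-identityʳ 1#
    }

  open import Algebra.Solver.Ring ℤ.+-*-rawRing (fromCommutativeRing R) homomorphism
    (λ i j → map (reflexive ∘ ≡.cong fromℤ) (dec⇒weaklyDec ℤ._≟_ i j)) public

module _ {q : ℕ} (F : FiniteField q) where
  open FiniteField F renaming (_+_ to infixl 6 _+_; _*_ to infixl 7 _*_; -_ to infix 8 -_)

  commutativeRing : CommutativeRing 0ℓ 0ℓ
  commutativeRing = record { isCommutativeRing = isCommutativeRing }

  open CommutativeRing commutativeRing
    using (+-comm; +-identityˡ; +-identityʳ; *-assoc; *-identityˡ; *-identityʳ; zeroˡ; zeroʳ; -‿inverseʳ)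
  open IntegerCoefficientSolver commutativeRing using (solve; _:=_; _:+_; _:*_; _:-_; con)
  open ≡.≡-Reasoning

  infixl 6 _-_
  _-_ : Carrier → Carrier → Carrier
  x - y = x + - y

  infixr 8 _^_
  _^_ : Carrier → ℕ → Carrier
  _^_ = pow F

  *-cancelˡ : ∀ {x y z} → x ≢ 0# → x * y ≡ x * z → y ≡ z
  *-cancelˡ {x} {y} {z} x≢0 xy≡xz with inverse x x≢0
  ... | x⁻¹ , xx⁻¹≡1 = begin
    y              ≡⟨ sym (*-identityˡ y) ⟩
    1# * y         ≡⟨ cong (_* y) (sym xx⁻¹≡1) ⟩
    x * x⁻¹ * y    ≡⟨ solve 3 (λ x x⁻¹ y → x :* x⁻¹ :* y := x⁻¹ :* (x :* y)) refl x x⁻¹ y ⟩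
    x⁻¹ * (x * y)  ≡⟨ cong (x⁻¹ *_) xy≡xz ⟩
    x⁻¹ * (x * z)  ≡⟨ solve 3 (λ x x⁻¹ z → x⁻¹ :* (x :* z) := x :* x⁻¹ :* z) refl x x⁻¹ z ⟩
    x * x⁻¹ * z    ≡⟨ cong (_* z) xx⁻¹≡1 ⟩
    1# * z         ≡⟨ *-identityˡ z ⟩
    z              ∎

  *-≢0 : ∀ {x y} → x ≢ 0# → y ≢ 0# → x * y ≢ 0#
  *-≢0 {x} x≢0 y≢0 xy≡0 = y≢0 (*-cancelˡ x≢0 (trans xy≡0 (sym (zeroʳ x))))

  x-y≡0⇒x≡y : ∀ {x y} → x - y ≡ 0# → x ≡ y
  x-y≡0⇒x≡y {x} {y} x-y≡0 = begin
    x            ≡⟨ solve 2 (λ x y → x := x :- y :+ y) refl x y ⟩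
    x - y + y    ≡⟨ cong (_+ y) x-y≡0 ⟩
    0# + y       ≡⟨ +-identityˡ y ⟩
    y            ∎

  ^-distribˡ-+-* : ∀ x m n → x ^ (m ℕ.+ n) ≡ x ^ m * x ^ n
  ^-distribˡ-+-* x zero    n = sym (*-identityˡ (x ^ n))
  ^-distribˡ-+-* x (suc m) n =
    trans (cong (x *_) (^-distribˡ-+-* x m n)) (sym (*-assoc x (x ^ m) (x ^ n)))

  ^-distribʳ-* : ∀ x y n → (x * y) ^ n ≡ x ^ n * y ^ n
  ^-distribʳ-* x y zero    = sym (*-identityˡ 1#)
  ^-distribʳ-* x y (suc n) = trans (cong (x * y *_) (^-distribʳ-* x y n))
    (solve 4 (λ x y xⁿ yⁿ → x :* y :* (xⁿ :* yⁿ) := x :* xⁿ :* (y :* yⁿ)) refl x y (x ^ n) (y ^ n))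

  ^-*-assoc : ∀ x m n → (x ^ m) ^ n ≡ x ^ (n ℕ.* m)
  ^-*-assoc x m zero    = refl
  ^-*-assoc x m (suc n) =
    trans (cong (x ^ m *_) (^-*-assoc x m n)) (sym (^-distribˡ-+-* x m (n ℕ.* m)))

  1^n≡1 : ∀ n → 1# ^ n ≡ 1#
  1^n≡1 zero    = refl
  1^n≡1 (suc n) = trans (*-identityˡ (1# ^ n)) (1^n≡1 n)

  ^-≢0 : ∀ {x} → x ≢ 0# → ∀ n → x ^ n ≢ 0#
  ^-≢0 x≢0 zero    1≡0 = 0≢1 (sym 1≡0)
  ^-≢0 x≢0 (suc n)     = *-≢0 x≢0 (^-≢0 x≢0 n)

  nonzero↣Fin⇒q≤1+ : ∀ {t} (ρ : ∀ x → x ≢ 0# → Fin t) →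
    (∀ {x y} x≢0 y≢0 → ρ x x≢0 ≡ ρ y y≢0 → x ≡ y) → q ≤ suc t
  nonzero↣Fin⇒q≤1+ {t} ρ ρ-injective =
    Finₚ.injective⇒≤ {f = encode ∘ Inverse.from enum} (from-injective ∘ encode-injective)
    where
    from-injective : ∀ {i j} → Inverse.from enum i ≡ Inverse.from enum j → i ≡ j
    from-injective = Injection.injective (↔⇒↣ (↔-sym enum))

    encode : Carrier → Fin (suc t)
    encode x with x ≟ 0#
    ... | yes _   = fromℕ t
    ... | no  x≢0 = inject₁ (ρ x x≢0)

    encode-injective : ∀ {x y} → encode x ≡ encode y → x ≡ y
    encode-injective {x} {y} e with x ≟ 0# | y ≟ 0#
    ... | yes x≡0 | yes y≡0 = trans x≡0 (sym y≡0)
    ... | yes _   | no  _   = ⊥-elim (Finₚ.fromℕ≢inject₁ e)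
    ... | no  _   | yes _   = ⊥-elim (Finₚ.fromℕ≢inject₁ (sym e))
    ... | no  x≢0 | no  y≢0 = ρ-injective x≢0 y≢0 (Finₚ.inject₁-injective e)

  primitive⇒≢0 : ∀ {α} → 3 ≤ q → IsPrimitive F α → α ≢ 0#
  primitive⇒≢0 {α} 3≤q α-primitive α≡0 =
    ℕₚ.<⇒≱ 3≤q (nonzero↣Fin⇒q≤1+ (λ _ _ → Fin.zero) λ x≢0 y≢0 _ →
      trans (nonzero≡1 x≢0) (sym (nonzero≡1 y≢0)))
    where
    nonzero≡1 : ∀ {x} → x ≢ 0# → x ≡ 1#
    nonzero≡1 {x} x≢0 with α-primitive x x≢0
    ... | zero  , x≡1 = x≡1
    ... | suc i , x≡α^[1+i] = ⊥-elim (x≢0 (trans x≡α^[1+i] (trans (cong (_* α ^ i) α≡0) (zeroˡ (α ^ i)))))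

  eval : Poly F → Carrier → Carrier
  eval []      y = 0#
  eval (c ∷ p) y = c + y * eval p y

  eval-addP : ∀ s t y → eval (addP F s t) y ≡ eval s y + eval t y
  eval-addP []      t       y = sym (+-identityˡ (eval t y))
  eval-addP (c ∷ s) []      y = sym (+-identityʳ (eval (c ∷ s) y))
  eval-addP (c ∷ s) (d ∷ t) y = trans (cong (λ z → c + d + y * z) (eval-addP s t y))
    (solve 5 (λ c d y s t → c :+ d :+ y :* (s :+ t) := c :+ y :* s :+ (d :+ y :* t))
           refl c d y (eval s y) (eval t y))

  eval-scaleP : ∀ a s y → eval (scaleP F a s) y ≡ a * eval s y
  eval-scaleP a []      y = sym (zeroʳ a)
  eval-scaleP a (c ∷ s) y = trans (cong (λ z → a * c + y * z) (eval-scaleP a s y))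
    (solve 4 (λ a c y s → a :* c :+ y :* (a :* s) := a :* (c :+ y :* s)) refl a c y (eval s y))

  eval-mulP : ∀ s t y → eval (mulP F s t) y ≡ eval s y * eval t y
  eval-mulP []      t y = sym (zeroˡ (eval t y))
  eval-mulP (c ∷ s) t y = begin
    eval (addP F (scaleP F c t) (0# ∷ mulP F s t)) y
      ≡⟨ eval-addP (scaleP F c t) (0# ∷ mulP F s t) y ⟩
    eval (scaleP F c t) y + (0# + y * eval (mulP F s t) y)
      ≡⟨ cong₂ (λ a b → a + (0# + y * b)) (eval-scaleP c t y) (eval-mulP s t y) ⟩
    c * eval t y + (0# + y * (eval s y * eval t y))
      ≡⟨ solve 4 (λ c t y s → c :* t :+ (con (+ 0) :+ y :* (s :* t)) := (c :+ y :* s) :* t)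
               refl c (eval t y) y (eval s y) ⟩
    (c + y * eval s y) * eval t y
      ∎

  length-addP : ∀ {n} s t → length s ≤ n → length t ≤ n → length (addP F s t) ≤ n
  length-addP []      t       _           |t|≤n       = |t|≤n
  length-addP (c ∷ s) []      |s|≤n       _           = |s|≤n
  length-addP (c ∷ s) (d ∷ t) (s≤s |s|≤n) (s≤s |t|≤n) = s≤s (length-addP s t |s|≤n |t|≤n)

  length-scaleP : ∀ a s → length (scaleP F a s) ≡ length s
  length-scaleP a []      = refl
  length-scaleP a (c ∷ s) = cong suc (length-scaleP a s)

  length-mulP : ∀ {m n} s t → length s ≤ m → length t ≤ suc n → length (mulP F s t) ≤ m ℕ.+ n
  length-mulP             []      t _           _        = z≤n
  length-mulP {suc m} {n} (c ∷ s) t (s≤s |s|≤m) |t|≤1+n =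
    length-addP (scaleP F c t) (0# ∷ mulP F s t)
      (subst (_≤ suc m ℕ.+ n) (sym (length-scaleP c t)) (ℕₚ.≤-trans |t|≤1+n (s≤s (ℕₚ.m≤n+m n m))))
      (s≤s (length-mulP s t |s|≤m |t|≤1+n))

  eval-const : ∀ c y → eval (c ∷ []) y ≡ c
  eval-const c y = trans (cong (_+_ c) (zeroʳ y)) (+-identityʳ c)

  coeff-≥length : ∀ p {i} → length p ≤ i → coeff F p i ≡ 0#
  coeff-≥length []      _           = refl
  coeff-≥length (c ∷ p) (s≤s |p|≤i) = coeff-≥length p |p|≤i

  evalUpTo : ℕ → (ℕ → Carrier) → Carrier → Carrier
  evalUpTo zero    f y = 0#
  evalUpTo (suc n) f y = evalUpTo n f y + f n * y ^ n

  ∀<-weaken : ∀ {n} {P : ℕ → Set} → (∀ i → i < suc n → P i) → ∀ i → i < n → P i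
  ∀<-weaken h i i<n = h i (ℕₚ.m≤n⇒m≤1+n i<n)

  evalUpTo-vanishing : ∀ n {f y} → (∀ i → i < n → f i ≡ 0#) → evalUpTo n f y ≡ 0#
  evalUpTo-vanishing zero    _ = refl
  evalUpTo-vanishing (suc n) {f} {y} f≡0 = begin
    evalUpTo n f y + f n * y ^ n
      ≡⟨ cong₂ (λ a b → a + b * y ^ n) (evalUpTo-vanishing n (∀<-weaken f≡0)) (f≡0 n ℕₚ.≤-refl) ⟩
    0# + 0# * y ^ n
      ≡⟨ solve 1 (λ p → con (+ 0) :+ con (+ 0) :* p := con (+ 0)) refl (y ^ n) ⟩
    0#
      ∎

  evalUpTo-single : ∀ {n f} y {e} → e < n → (∀ i → i < n → i ≢ e → f i ≡ 0#) →
                    evalUpTo n f y ≡ f e * y ^ e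
  evalUpTo-single {suc n} {f} y e<1+n f≡0 with ℕₚ.m<1+n⇒m<n∨m≡n e<1+n
  ... | inj₂ refl = trans (cong (_+ f n * y ^ n) rest≡0) (+-identityˡ (f n * y ^ n))
    where
    rest≡0 : evalUpTo n f y ≡ 0#
    rest≡0 = evalUpTo-vanishing n (λ i i<n → f≡0 i (ℕₚ.m≤n⇒m≤1+n i<n) (ℕₚ.<⇒≢ i<n))
  ... | inj₁ e<n = trans (cong₂ _+_ (evalUpTo-single y e<n (∀<-weaken f≡0)) top≡0) (+-identityʳ _)
    where
    top≡0 : f n * y ^ n ≡ 0#
    top≡0 = trans (cong (_* y ^ n) (f≡0 n ℕₚ.≤-refl (ℕₚ.<⇒≢ e<n ∘ sym))) (zeroˡ (y ^ n))

  evalUpTo-sub : ∀ n f g y → evalUpTo n (λ i → f i - g i) y ≡ evalUpTo n f y - evalUpTo n g y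
  evalUpTo-sub zero    f g y = sym (-‿inverseʳ 0#)
  evalUpTo-sub (suc n) f g y = trans (cong (_+ (f n - g n) * y ^ n) (evalUpTo-sub n f g y))
    (solve 5 (λ S T a b p → S :- T :+ (a :- b) :* p := S :+ a :* p :- (T :+ b :* p))
           refl (evalUpTo n f y) (evalUpTo n g y) (f n) (g n) (y ^ n))

  evalUpTo-twist : ∀ α n f b y →
    evalUpTo n (λ i → f i * (α ^ i - b)) y ≡ evalUpTo n f (α * y) - b * evalUpTo n f y
  evalUpTo-twist α zero    f b y = solve 1 (λ b → con (+ 0) := con (+ 0) :- b :* con (+ 0)) refl b
  evalUpTo-twist α (suc n) f b y = begin
    evalUpTo n (λ i → f i * (α ^ i - b)) y + f n * (α ^ n - b) * y ^ n
      ≡⟨ cong (_+ f n * (α ^ n - b) * y ^ n) (evalUpTo-twist α n f b y) ⟩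
    evalUpTo n f (α * y) - b * evalUpTo n f y + f n * (α ^ n - b) * y ^ n
      ≡⟨ solve 6 (λ S T b a x p → S :- b :* T :+ a :* (x :- b) :* p := S :+ a :* (x :* p) :- b :* (T :+ a :* p))
               refl (evalUpTo n f (α * y)) (evalUpTo n f y) b (f n) (α ^ n) (y ^ n) ⟩
    evalUpTo n f (α * y) + f n * (α ^ n * y ^ n) - b * (evalUpTo n f y + f n * y ^ n)
      ≡⟨ cong (λ z → evalUpTo n f (α * y) + f n * z - b * (evalUpTo n f y + f n * y ^ n))
              (sym (^-distribʳ-* α y n)) ⟩
    evalUpTo n f (α * y) + f n * (α * y) ^ n - b * (evalUpTo n f y + f n * y ^ n)
      ∎

  evalUpTo-suc : ∀ n f y → evalUpTo (suc n) f y ≡ f 0 + y * evalUpTo n (f ∘ suc) y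
  evalUpTo-suc zero    f y = begin
    0# + f 0 * 1#  ≡⟨ trans (+-identityˡ (f 0 * 1#)) (*-identityʳ (f 0)) ⟩
    f 0            ≡⟨ sym (trans (cong (_+_ (f 0)) (zeroʳ y)) (+-identityʳ (f 0))) ⟩
    f 0 + y * 0#   ∎
  evalUpTo-suc (suc n) f y = begin
    evalUpTo (suc n) f y + f (suc n) * (y * y ^ n)
      ≡⟨ cong (_+ f (suc n) * (y * y ^ n)) (evalUpTo-suc n f y) ⟩
    f 0 + y * evalUpTo n (f ∘ suc) y + f (suc n) * (y * y ^ n)
      ≡⟨ solve 5 (λ a y s b p → a :+ y :* s :+ b :* (y :* p) := a :+ y :* (s :+ b :* p))
               refl (f 0) y (evalUpTo n (f ∘ suc) y) (f (suc n)) (y ^ n) ⟩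
    f 0 + y * (evalUpTo n (f ∘ suc) y + f (suc n) * y ^ n)
      ∎

  eval≡evalUpTo : ∀ p {n} y → length p ≤ n → eval p y ≡ evalUpTo n (coeff F p) y
  eval≡evalUpTo []      {n}     y _ = sym (evalUpTo-vanishing n (λ _ _ → refl))
  eval≡evalUpTo (c ∷ p) {suc n} y (s≤s |p|≤n) =
    trans (cong (λ z → c + y * z) (eval≡evalUpTo p y |p|≤n)) (sym (evalUpTo-suc n (coeff F (c ∷ p)) y))

  weight : ℕ → (ℕ → Carrier) → ℕ
  weight zero    f = 0
  weight (suc n) f with f n ≟ 0#
  ... | yes _ = weight n f
  ... | no  _ = suc (weight n f)

  weight≤0⇒vanishes : ∀ {n} f → weight n f ≤ 0 → ∀ i → i < n → f i ≡ 0#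
  weight≤0⇒vanishes {suc n} f wt≤0 i i<1+n with f n ≟ 0# | ℕₚ.m<1+n⇒m<n∨m≡n i<1+n
  ... | yes fn≡0 | inj₂ refl = fn≡0
  ... | yes _    | inj₁ i<n  = weight≤0⇒vanishes f wt≤0 i i<n
  weight≤0⇒vanishes {suc n} f () i i<1+n | no _ | _

  weight-≤ : ∀ n f → weight n f ≤ n
  weight-≤ zero    f = z≤n
  weight-≤ (suc n) f with f n ≟ 0#
  ... | yes _ = ℕₚ.m≤n⇒m≤1+n (weight-≤ n f)
  ... | no  _ = s≤s (weight-≤ n f)

  weight-mono : ∀ n {f g} → (∀ i → i < n → f i ≡ 0# → g i ≡ 0#) → weight n g ≤ weight n f
  weight-mono zero    _ = z≤n
  weight-mono (suc n) {f} {g} supp with f n ≟ 0# | g n ≟ 0#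
  ... | yes _    | yes _   = weight-mono n (∀<-weaken supp)
  ... | yes fn≡0 | no gn≢0 = ⊥-elim (gn≢0 (supp n ℕₚ.≤-refl fn≡0))
  ... | no  _    | yes _   = ℕₚ.m≤n⇒m≤1+n (weight-mono n (∀<-weaken supp))
  ... | no  _    | no  _   = s≤s (weight-mono n (∀<-weaken supp))

  weight-mono-< : ∀ n {f g e} → (∀ i → i < n → f i ≡ 0# → g i ≡ 0#) →
                  e < n → g e ≡ 0# → f e ≢ 0# → weight n g < weight n f
  weight-mono-< (suc n) {f} {g} supp e<1+n ge≡0 fe≢0 with f n ≟ 0# | g n ≟ 0# | ℕₚ.m<1+n⇒m<n∨m≡n e<1+n
  ... | yes fn≡0 | _       | inj₂ refl = ⊥-elim (fe≢0 fn≡0)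
  ... | yes _    | yes _   | inj₁ e<n  = weight-mono-< n (∀<-weaken supp) e<n ge≡0 fe≢0
  ... | yes fn≡0 | no gn≢0 | _         = ⊥-elim (gn≢0 (supp n ℕₚ.≤-refl fn≡0))
  ... | no  _    | yes _   | _         = s≤s (weight-mono n (∀<-weaken supp))
  ... | no  _    | no gn≢0 | inj₂ refl = ⊥-elim (gn≢0 ge≡0)
  ... | no  _    | no  _   | inj₁ e<n  = s≤s (weight-mono-< n (∀<-weaken supp) e<n ge≡0 fe≢0)

  weight-≤-pred : ∀ n {f} → f 0 ≡ 0# → weight n f ≤ n ∸ 1
  weight-≤-pred zero _ = z≤n
  weight-≤-pred (suc n) {f} f0≡0 with f n ≟ 0#
  ... | yes _ = ℕₚ.≤-trans (weight-≤-pred n f0≡0) (ℕₚ.m∸n≤m n 1)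
  weight-≤-pred (suc zero)    f0≡0 | no f0≢0 = ⊥-elim (f0≢0 f0≡0)
  weight-≤-pred (suc (suc n)) f0≡0 | no _    = s≤s (weight-≤-pred (suc n) f0≡0)

  weight-≤-degree : ∀ n {f d} → f 0 ≡ 0# → (∀ i → suc d ≤ i → f i ≡ 0#) → weight n f ≤ d
  weight-≤-degree zero    _ _ = z≤n
  weight-≤-degree (suc n) {f} f0≡0 high with f n ≟ 0#
  ... | yes _ = weight-≤-degree n f0≡0 high
  weight-≤-degree (suc zero)    f0≡0 high | no f0≢0 = ⊥-elim (f0≢0 f0≡0)
  weight-≤-degree (suc (suc n)) f0≡0 high | no fn≢0 =
    ℕₚ.≤-trans (s≤s (weight-≤-pred (suc n) f0≡0)) (ℕₚ.≤-pred (ℕₚ.≰⇒> (fn≢0 ∘ high (suc n))))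

  diff : Poly F → Poly F → ℕ → Carrier
  diff s t i = coeff F s i - coeff F t i

  dist≡weight-diff : ∀ n s t → dist F n s t ≡ weight n (diff s t)
  dist≡weight-diff zero    s t = refl
  dist≡weight-diff (suc n) s t with coeff F s n ≟ coeff F t n | diff s t n ≟ 0#
  ... | yes _   | yes _   = dist≡weight-diff n s t
  ... | yes s≡t | no δ≢0  = ⊥-elim (δ≢0 (trans (cong (_- coeff F t n) s≡t) (-‿inverseʳ (coeff F t n))))
  ... | no  s≢t | yes δ≡0 = ⊥-elim (s≢t (x-y≡0⇒x≡y δ≡0))
  ... | no  _   | no  _   = cong suc (dist≡weight-diff n s t)

  evalUpTo-diff : ∀ {n} s t y → length s ≤ n → length t ≤ n →
                  evalUpTo n (diff s t) y ≡ eval s y - eval t y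
  evalUpTo-diff {n} s t y |s|≤n |t|≤n = trans (evalUpTo-sub n (coeff F s) (coeff F t) y)
    (sym (cong₂ _-_ (eval≡evalUpTo s y |s|≤n) (eval≡evalUpTo t y |t|≤n)))

  module _ (α : Carrier) where

    length-rootProd : ∀ n → length (rootProd F α n) ≤ suc n
    length-rootProd zero    = s≤s z≤n
    length-rootProd (suc n) = subst (length (rootProd F α (suc n)) ≤_) (ℕₚ.+-comm (suc n) 1)
      (length-mulP (rootProd F α n) (- α ^ suc n ∷ 1# ∷ []) (length-rootProd n) ℕₚ.≤-refl)

    eval-rootProd-suc : ∀ n y → eval (rootProd F α (suc n)) y ≡ eval (rootProd F α n) y * (y - α ^ suc n)
    eval-rootProd-suc n y =
      trans (eval-mulP (rootProd F α n) (- α ^ suc n ∷ 1# ∷ []) y) (cong (eval (rootProd F α n) y *_) linear)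
      where
      linear : - α ^ suc n + y * eval (1# ∷ []) y ≡ y - α ^ suc n
      linear = begin
        - α ^ suc n + y * eval (1# ∷ []) y  ≡⟨ cong (λ z → - α ^ suc n + y * z) (eval-const 1# y) ⟩
        - α ^ suc n + y * 1#             ≡⟨ cong (_+_ (- α ^ suc n)) (*-identityʳ y) ⟩
        - α ^ suc n + y                  ≡⟨ +-comm (- α ^ suc n) y ⟩
        y - α ^ suc n                    ∎

    rootProd-vanishes : ∀ n {j} → 1 ≤ j → j ≤ n → eval (rootProd F α n) (α ^ j) ≡ 0#
    rootProd-vanishes zero    (s≤s _) ()
    rootProd-vanishes (suc n) {j} 1≤j j≤1+n with ℕₚ.m≤n⇒m<n∨m≡n j≤1+n
    ... | inj₂ refl = trans (eval-rootProd-suc n (α ^ j))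
                            (trans (cong (eval (rootProd F α n) (α ^ j) *_) (-‿inverseʳ (α ^ j))) (zeroʳ _))
    ... | inj₁ j<1+n = trans (eval-rootProd-suc n (α ^ j))
                             (trans (cong (_* (α ^ j - α ^ suc n)) (rootProd-vanishes n 1≤j (ℕₚ.≤-pred j<1+n)))
                                    (zeroˡ _))

    rootProd-≢0 : ∀ n {y} → (∀ j → 1 ≤ j → j ≤ n → y ≢ α ^ j) → eval (rootProd F α n) y ≢ 0#
    rootProd-≢0 zero    {y} _ g[y]≡0 = 0≢1 (trans (sym g[y]≡0) (eval-const 1# y))
    rootProd-≢0 (suc n) {y} y∉roots g[y]≡0 =
      *-≢0 (rootProd-≢0 n (λ j 1≤j j≤n → y∉roots j 1≤j (ℕₚ.m≤n⇒m≤1+n j≤n)))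
           (y∉roots (suc n) (s≤s z≤n) ℕₚ.≤-refl ∘ x-y≡0⇒x≡y)
           (trans (sym (eval-rootProd-suc n y)) g[y]≡0)

  subConstant : ∀ {k} → Carrier → Vec Carrier (suc k) → Vec Carrier (suc k)
  subConstant c (m₀ ∷ m) = m₀ - c ∷ m

  eval-subConstant : ∀ {k} c (m : Vec Carrier (suc k)) y →
                     eval (toList (subConstant c m)) y ≡ eval (toList m) y - c
  eval-subConstant c (m₀ ∷ m) y =
    solve 4 (λ m₀ c y M → m₀ :- c :+ y :* M := m₀ :+ y :* M :- c) refl m₀ c y (eval (toList m) y)

  DistToMultiples≡ : (k : ℕ) → Poly F → Poly F → ℕ → Set
  DistToMultiples≡ k g u r =
    (∀ (m : Vec Carrier k) → r ≤ dist F (q ∸ 1) u (mulP F g (toList m)))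
    × Σ (Vec Carrier k) λ m → dist F (q ∸ 1) u (mulP F g (toList m)) ≡ r

  module Primitive {α : Carrier} (α-primitive : IsPrimitive F α) (α≢0 : α ≢ 0#) where

    ^-mod : ∀ {t} → α ^ suc t ≡ 1# → ∀ i → α ^ i ≡ α ^ (i % suc t)
    ^-mod {t} α^[1+t]≡1 i = begin
      α ^ i
        ≡⟨ cong (α ^_) (m≡m%n+[m/n]*n i (suc t)) ⟩
      α ^ (i % suc t ℕ.+ i / suc t ℕ.* suc t)
        ≡⟨ ^-distribˡ-+-* α (i % suc t) (i / suc t ℕ.* suc t) ⟩
      α ^ (i % suc t) * α ^ (i / suc t ℕ.* suc t)
        ≡⟨ cong (α ^ (i % suc t) *_) (sym (^-*-assoc α (suc t) (i / suc t))) ⟩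
      α ^ (i % suc t) * (α ^ suc t) ^ (i / suc t)
        ≡⟨ cong (λ z → α ^ (i % suc t) * z ^ (i / suc t)) α^[1+t]≡1 ⟩
      α ^ (i % suc t) * 1# ^ (i / suc t)
        ≡⟨ cong (α ^ (i % suc t) *_) (1^n≡1 (i / suc t)) ⟩
      α ^ (i % suc t) * 1#
        ≡⟨ *-identityʳ (α ^ (i % suc t)) ⟩
      α ^ (i % suc t)
        ∎

    ^≡1⇒q∸1≤ : ∀ {t} → 0 < t → α ^ t ≡ 1# → q ∸ 1 ≤ t
    ^≡1⇒q∸1≤ {suc t} _ α^[1+t]≡1 = ℕₚ.∸-monoˡ-≤ 1 (nonzero↣Fin⇒q≤1+ residue residue-injective)
      where
      residue : ∀ x → x ≢ 0# → Fin (suc t)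
      residue x x≢0 = fromℕ< (m%n<n (proj₁ (α-primitive x x≢0)) (suc t))

      residue-injective : ∀ {x y} x≢0 y≢0 → residue x x≢0 ≡ residue y y≢0 → x ≡ y
      residue-injective {x} {y} x≢0 y≢0 e with α-primitive x x≢0 | α-primitive y y≢0
      ... | i , x≡α^i | j , y≡α^j = begin
        x                ≡⟨ x≡α^i ⟩
        α ^ i            ≡⟨ ^-mod α^[1+t]≡1 i ⟩
        α ^ (i % suc t)  ≡⟨ cong (α ^_) (Finₚ.fromℕ<-injective _ _ (m%n<n i (suc t)) (m%n<n j (suc t)) e) ⟩
        α ^ (j % suc t)  ≡⟨ sym (^-mod α^[1+t]≡1 j) ⟩
        α ^ j            ≡⟨ sym y≡α^j ⟩
        y                ∎

    α^i≢α^j : ∀ {i j} → i < j → j < q ∸ 1 → α ^ i ≢ α ^ j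
    α^i≢α^j {i} {j} i<j j<q∸1 α^i≡α^j = ℕₚ.<⇒≱ j<q∸1 (ℕₚ.≤-trans q∸1≤j∸i (ℕₚ.m∸n≤m j i))
      where
      α^[j∸i]≡1 : α ^ (j ∸ i) ≡ 1#
      α^[j∸i]≡1 = *-cancelˡ (^-≢0 α≢0 i) (begin
        α ^ i * α ^ (j ∸ i)  ≡⟨ sym (^-distribˡ-+-* α i (j ∸ i)) ⟩
        α ^ (i ℕ.+ (j ∸ i))  ≡⟨ cong (α ^_) (ℕₚ.m+[n∸m]≡n (ℕₚ.<⇒≤ i<j)) ⟩
        α ^ j                ≡⟨ sym α^i≡α^j ⟩
        α ^ i                ≡⟨ sym (*-identityʳ (α ^ i)) ⟩
        α ^ i * 1#           ∎)

      q∸1≤j∸i : q ∸ 1 ≤ j ∸ i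
      q∸1≤j∸i = ^≡1⇒q∸1≤ (ℕₚ.m<n⇒0<n∸m i<j) α^[j∸i]≡1

    ^-injective : ∀ {i j} → i < q ∸ 1 → j < q ∸ 1 → α ^ i ≡ α ^ j → i ≡ j
    ^-injective {i} {j} i<q∸1 j<q∸1 α^i≡α^j with ℕₚ.<-cmp i j
    ... | tri< i<j _ _ = ⊥-elim (α^i≢α^j i<j j<q∸1 α^i≡α^j)
    ... | tri≈ _ i≡j _ = i≡j
    ... | tri> _ _ j<i = ⊥-elim (α^i≢α^j j<i i<q∸1 (sym α^i≡α^j))

    -- Induction on w: if f e ≢ 0, the coefficients f i (α^i - α^e) have smaller weight, and
    -- their series, being f(α y) - α^e f(y), vanishes at α, …, α^w when f does at α, …, α^(w+1).
    bch-bound : ∀ {n} → n ≤ q ∸ 1 → ∀ w f → weight n f ≤ w →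
                (∀ j → 1 ≤ j → j ≤ w → evalUpTo n f (α ^ j) ≡ 0#) →
                ∀ i → i < n → f i ≡ 0#
    bch-bound n≤q∸1 zero f wt≤0 _ = weight≤0⇒vanishes f wt≤0
    bch-bound {n} n≤q∸1 (suc w) f wt≤1+w f-roots e e<n with f e ≟ 0#
    ... | yes fe≡0 = fe≡0
    ... | no  fe≢0 =
      ⊥-elim (*-≢0 fe≢0 (^-≢0 (^-≢0 α≢0 1) e) (trans (sym f[α]≡) (f-roots 1 ℕₚ.≤-refl (s≤s z≤n))))
      where
      g : ℕ → Carrier
      g i = f i * (α ^ i - α ^ e)

      g-roots : ∀ j → 1 ≤ j → j ≤ w → evalUpTo n g (α ^ j) ≡ 0#
      g-roots j 1≤j j≤w = begin
        evalUpTo n g (α ^ j)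
          ≡⟨ evalUpTo-twist α n f (α ^ e) (α ^ j) ⟩
        evalUpTo n f (α ^ suc j) - α ^ e * evalUpTo n f (α ^ j)
          ≡⟨ cong₂ (λ s t → s - α ^ e * t) (f-roots (suc j) (s≤s z≤n) (s≤s j≤w))
                                           (f-roots j 1≤j (ℕₚ.m≤n⇒m≤1+n j≤w)) ⟩
        0# - α ^ e * 0#
          ≡⟨ solve 1 (λ b → con (+ 0) :- b :* con (+ 0) := con (+ 0)) refl (α ^ e) ⟩
        0#
          ∎

      g-vanishes : ∀ i → i < n → g i ≡ 0#
      g-vanishes = bch-bound n≤q∸1 w g (ℕₚ.≤-pred (ℕₚ.≤-trans weight-g<weight-f wt≤1+w)) g-roots
        where
        weight-g<weight-f : weight n g < weight n f
        weight-g<weight-f = weight-mono-< n (λ i _ fi≡0 → trans (cong (_* (α ^ i - α ^ e)) fi≡0) (zeroˡ _))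
          e<n (trans (cong (f e *_) (-‿inverseʳ (α ^ e))) (zeroʳ (f e))) fe≢0

      f-supported-at-e : ∀ i → i < n → i ≢ e → f i ≡ 0#
      f-supported-at-e i i<n i≢e with f i ≟ 0#
      ... | yes fi≡0 = fi≡0
      ... | no  fi≢0 = ⊥-elim (i≢e (^-injective (ℕₚ.<-≤-trans i<n n≤q∸1) (ℕₚ.<-≤-trans e<n n≤q∸1)
                                     (x-y≡0⇒x≡y (*-cancelˡ fi≢0 (trans (g-vanishes i i<n) (sym (zeroʳ (f i))))))))

      f[α]≡ : evalUpTo n f (α ^ 1) ≡ f e * (α ^ 1) ^ e
      f[α]≡ = evalUpTo-single (α ^ 1) e<n f-supported-at-e

    evalUpTo-injective : ∀ {n} → n ≤ q ∸ 1 → ∀ f g →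
      (∀ j → 1 ≤ j → j ≤ n → evalUpTo n f (α ^ j) ≡ evalUpTo n g (α ^ j)) → ∀ i → i < n → f i ≡ g i
    evalUpTo-injective {n} n≤q∸1 f g agree i i<n =
      x-y≡0⇒x≡y (bch-bound n≤q∸1 n (λ i → f i - g i) (weight-≤ n _) f-g-roots i i<n)
      where
      f-g-roots : ∀ j → 1 ≤ j → j ≤ n → evalUpTo n (λ i → f i - g i) (α ^ j) ≡ 0#
      f-g-roots j 1≤j j≤n = trans (evalUpTo-sub n f g (α ^ j))
        (trans (cong (_- evalUpTo n g (α ^ j)) (agree j 1≤j j≤n)) (-‿inverseʳ (evalUpTo n g (α ^ j))))

    module DeepHole (w k : ℕ) (q∸1≡ : q ∸ 1 ≡ suc w ℕ.+ suc k)
                    {a : Carrier} (a≢0 : a ≢ 0#) (l : Vec Carrier (suc k)) where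

      g₂ g : Poly F
      g₂ = rootProd F α w
      g  = rootProd F α (suc w)

      β : Carrier
      β = α ^ suc w

      u : Poly F
      u = addP F (scaleP F a g₂) (mulP F (toList l) g)

      multiple : Vec Carrier (suc k) → Poly F
      multiple m = mulP F g (toList m)

      δ : Vec Carrier (suc k) → ℕ → Carrier
      δ m = diff u (multiple m)

      2+w≤q∸1 : suc (suc w) ≤ q ∸ 1
      2+w≤q∸1 = subst (suc (suc w) ≤_) (sym q∸1≡)
        (s≤s (ℕₚ.≤-trans (ℕₚ.m≤m+n (suc w) k) (ℕₚ.≤-reflexive (sym (ℕₚ.+-suc w k)))))

      length-u : length u ≤ q ∸ 1
      length-u = length-addP (scaleP F a g₂) (mulP F (toList l) g)
        (subst (_≤ q ∸ 1) (sym (length-scaleP a g₂)) (ℕₚ.≤-trans (length-rootProd α w) (ℕₚ.<⇒≤ 2+w≤q∸1)))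
        (subst (length (mulP F (toList l) g) ≤_) (trans (ℕₚ.+-comm (suc k) (suc w)) (sym q∸1≡))
          (length-mulP (toList l) g (ℕₚ.≤-reflexive (length-toList l)) (length-rootProd α (suc w))))

      length-multiple : ∀ m → length (multiple m) ≤ q ∸ 1
      length-multiple m = subst (length (multiple m) ≤_) (trans (sym (ℕₚ.+-suc (suc w) k)) (sym q∸1≡))
        (length-mulP g (toList m) (length-rootProd α (suc w)) (ℕₚ.≤-reflexive (length-toList m)))

      evalUpTo-δ : ∀ m y → evalUpTo (q ∸ 1) (δ m) y ≡
                   a * eval g₂ y + (eval (toList l) y - eval (toList m) y) * eval g y
      evalUpTo-δ m y = begin
        evalUpTo (q ∸ 1) (δ m) y
          ≡⟨ evalUpTo-diff u (multiple m) y length-u (length-multiple m) ⟩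
        eval u y - eval (multiple m) y
          ≡⟨ cong₂ _-_ (trans (eval-addP (scaleP F a g₂) (mulP F (toList l) g) y)
                              (cong₂ _+_ (eval-scaleP a g₂ y) (eval-mulP (toList l) g y)))
                       (eval-mulP g (toList m) y) ⟩
        a * eval g₂ y + eval (toList l) y * eval g y - eval g y * eval (toList m) y
          ≡⟨ solve 5 (λ a G₂ L G M → a :* G₂ :+ L :* G :- G :* M := a :* G₂ :+ (L :- M) :* G)
                   refl a (eval g₂ y) (eval (toList l) y) (eval g y) (eval (toList m) y) ⟩
        a * eval g₂ y + (eval (toList l) y - eval (toList m) y) * eval g y
          ∎

      δ-roots : ∀ m j → 1 ≤ j → j ≤ w → evalUpTo (q ∸ 1) (δ m) (α ^ j) ≡ 0#
      δ-roots m j 1≤j j≤w = begin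
        evalUpTo (q ∸ 1) (δ m) (α ^ j)
          ≡⟨ evalUpTo-δ m (α ^ j) ⟩
        a * eval g₂ (α ^ j) + D * eval g (α ^ j)
          ≡⟨ cong₂ (λ s t → a * s + D * t) (rootProd-vanishes α w 1≤j j≤w)
                                           (rootProd-vanishes α (suc w) 1≤j (ℕₚ.m≤n⇒m≤1+n j≤w)) ⟩
        a * 0# + D * 0#
          ≡⟨ solve 2 (λ a D → a :* con (+ 0) :+ D :* con (+ 0) := con (+ 0)) refl a D ⟩
        0#
          ∎
        where
        D : Carrier
        D = eval (toList l) (α ^ j) - eval (toList m) (α ^ j)

      g₂[β]≢0 : eval g₂ β ≢ 0#
      g₂[β]≢0 = rootProd-≢0 α w λ j _ j≤w β≡α^j →
        ℕₚ.<⇒≢ (s≤s j≤w) (^-injective (ℕₚ.<-trans (s≤s j≤w) 2+w≤q∸1) 2+w≤q∸1 (sym β≡α^j))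

      w<weight-δ : ∀ m → w < weight (q ∸ 1) (δ m)
      w<weight-δ m = ℕₚ.≰⇒> λ weight≤w → *-≢0 a≢0 g₂[β]≢0 (begin
        a * eval g₂ β
          ≡⟨ solve 2 (λ A D → A := A :+ D :* con (+ 0)) refl (a * eval g₂ β) D ⟩
        a * eval g₂ β + D * 0#
          ≡⟨ cong (λ z → a * eval g₂ β + D * z) (sym (rootProd-vanishes α (suc w) (s≤s z≤n) ℕₚ.≤-refl)) ⟩
        a * eval g₂ β + D * eval g β
          ≡⟨ sym (evalUpTo-δ m β) ⟩
        evalUpTo (q ∸ 1) (δ m) β
          ≡⟨ evalUpTo-vanishing (q ∸ 1) (bch-bound ℕₚ.≤-refl w (δ m) weight≤w (δ-roots m)) ⟩
        0#
          ∎)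
        where
        D : Carrier
        D = eval (toList l) β - eval (toList m) β

      c : Carrier
      c = a * proj₁ (inverse β (^-≢0 α≢0 (suc w)))

      c*β≡a : c * β ≡ a
      c*β≡a with inverse β (^-≢0 α≢0 (suc w))
      ... | β⁻¹ , ββ⁻¹≡1 = begin
        a * β⁻¹ * β    ≡⟨ solve 3 (λ a b b⁻¹ → a :* b⁻¹ :* b := a :* (b :* b⁻¹)) refl a β β⁻¹ ⟩
        a * (β * β⁻¹)  ≡⟨ cong (a *_) ββ⁻¹≡1 ⟩
        a * 1#         ≡⟨ *-identityʳ a ⟩
        a              ∎

      m* : Vec Carrier (suc k)
      m* = subConstant c l

      -- u - g m* = a g₂ + c g = a g₂ + c (x - β) g₂ = c x g₂, since c β = a.
      E : Poly F
      E = 0# ∷ scaleP F c g₂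

      length-E : length E ≤ suc (suc w)
      length-E = s≤s (subst (_≤ suc w) (sym (length-scaleP c g₂)) (length-rootProd α w))

      evalUpTo-δ*≡eval-E : ∀ y → evalUpTo (q ∸ 1) (δ m*) y ≡ eval E y
      evalUpTo-δ*≡eval-E y = begin
        evalUpTo (q ∸ 1) (δ m*) y
          ≡⟨ evalUpTo-δ m* y ⟩
        a * eval g₂ y + (L - eval (toList m*) y) * eval g y
          ≡⟨ cong₂ (λ s t → a * eval g₂ y + (L - s) * t) (eval-subConstant c l y) (eval-rootProd-suc α w y) ⟩
        a * eval g₂ y + (L - (L - c)) * (eval g₂ y * (y - β))
          ≡⟨ cong (λ z → z * eval g₂ y + (L - (L - c)) * (eval g₂ y * (y - β))) (sym c*β≡a) ⟩
        c * β * eval g₂ y + (L - (L - c)) * (eval g₂ y * (y - β))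
          ≡⟨ solve 5 (λ c b G₂ L y → c :* b :* G₂ :+ (L :- (L :- c)) :* (G₂ :* (y :- b))
                                     := con (+ 0) :+ y :* (c :* G₂))
                   refl c β (eval g₂ y) L y ⟩
        0# + y * (c * eval g₂ y)
          ≡⟨ cong (λ z → 0# + y * z) (sym (eval-scaleP c g₂ y)) ⟩
        eval E y
          ∎
        where
        L : Carrier
        L = eval (toList l) y

      δ*≡coeff-E : ∀ i → i < q ∸ 1 → δ m* i ≡ coeff F E i
      δ*≡coeff-E = evalUpTo-injective ℕₚ.≤-refl (δ m*) (coeff F E) λ j _ _ →
        trans (evalUpTo-δ*≡eval-E (α ^ j)) (eval≡evalUpTo E (α ^ j) (ℕₚ.≤-trans length-E 2+w≤q∸1))

      weight-δ*≤1+w : weight (q ∸ 1) (δ m*) ≤ suc w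
      weight-δ*≤1+w = ℕₚ.≤-trans
        (weight-mono (q ∸ 1) λ i i<q∸1 Eᵢ≡0 → trans (δ*≡coeff-E i i<q∸1) Eᵢ≡0)
        (weight-≤-degree (q ∸ 1) refl λ i 2+w≤i → coeff-≥length E (ℕₚ.≤-trans length-E 2+w≤i))

      distance : DistToMultiples≡ (suc k) g u (suc w)
      distance = lower , m* , ℕₚ.≤-antisym upper (lower m*)
        where
        lower : ∀ m → suc w ≤ dist F (q ∸ 1) u (multiple m)
        lower m = subst (suc w ≤_) (sym (dist≡weight-diff (q ∸ 1) u (multiple m))) (w<weight-δ m)

        upper : dist F (q ∸ 1) u (multiple m*) ≤ suc w
        upper = subst (_≤ suc w) (sym (dist≡weight-diff (q ∸ 1) u (multiple m*))) weight-δ*≤1+w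

    -- d is kept apart from suc w so that it can be instantiated with q ∸ k ∸ 1.
    deep-hole : ∀ w k {d} → d ≡ suc w → q ∸ 1 ≡ d ℕ.+ suc k →
                ∀ {a} → a ≢ 0# → (l : Vec Carrier (suc k)) →
                DistToMultiples≡ (suc k) (rootProd F α d)
                  (addP F (scaleP F a (rootProd F α w)) (mulP F (toList l) (rootProd F α d))) d
    deep-hole w k refl q∸1≡ a≢0 l = DeepHole.distance w k q∸1≡ a≢0 l

open import Data.Nat using (_+_)

theorem2p4 : ∀ {q : ℕ} (F : FiniteField q) → IsPrimePower q →
    (α : FiniteField.Carrier F) → IsPrimitive F α →
    (k : ℕ) → 1 ≤ k → k + 2 ≤ q →
    (a : FiniteField.Carrier F) → ¬ (a ≡ FiniteField.0# F) →
    (l : Vec (FiniteField.Carrier F) k) →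
    IsDeepHole F k α
      (addP F (scaleP F a (rootProd F α (q ∸ k ∸ 2)))
              (mulP F (toList l) (gen F k α)))
theorem2p4     F _ α α-primitive zero    () _
theorem2p4 {q} F _ α α-primitive (suc k) _  k+3≤q a a≢0 l =
  subst (DistToCode≡ F (suc k) α u) d≡q∸1∸k
    (Primitive.deep-hole F α-primitive α≢0 (q ∸ suc k ∸ 2) k d≡1+w q∸1≡d+k a≢0 l)
  where
  u : Poly F
  u = addP F (scaleP F a (rootProd F α (q ∸ suc k ∸ 2))) (mulP F (toList l) (gen F (suc k) α))

  α≢0 : α ≢ FiniteField.0# F
  α≢0 = primitive⇒≢0 F (ℕₚ.≤-trans (s≤s (ℕₚ.m≤n+m 2 k)) k+3≤q) α-primitive

  d≡1+w : q ∸ suc k ∸ 1 ≡ suc (q ∸ suc k ∸ 2)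
  d≡1+w = m∸1≡1+[m∸2] (ℕₚ.m+n≤o⇒m≤o∸n 2 (subst (_≤ q) (ℕₚ.+-comm (suc k) 2) k+3≤q))
    where
    m∸1≡1+[m∸2] : ∀ {m} → 2 ≤ m → m ∸ 1 ≡ suc (m ∸ 2)
    m∸1≡1+[m∸2] (s≤s (s≤s _)) = refl

  d≡q∸1∸k : q ∸ suc k ∸ 1 ≡ q ∸ 1 ∸ suc k
  d≡q∸1∸k = trans (ℕₚ.∸-+-assoc q (suc k) 1)
                  (trans (cong (q ∸_) (ℕₚ.+-comm (suc k) 1)) (sym (ℕₚ.∸-+-assoc q 1 (suc k))))

  q∸1≡d+k : q ∸ 1 ≡ q ∸ suc k ∸ 1 ℕ.+ suc k
  q∸1≡d+k = sym (trans (cong (ℕ._+ suc k) d≡q∸1∸k) (ℕₚ.m∸n+n≡m 1+k≤q∸1))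
    where
    1+k≤q∸1 : suc k ≤ q ∸ 1
    1+k≤q∸1 = ℕₚ.m+n≤o⇒m≤o∸n (suc k) (ℕₚ.≤-trans (ℕₚ.+-monoʳ-≤ (suc k) (s≤s z≤n)) k+3≤q)
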